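{- Let $A$ be a finite multiset of positive reals, $a$ a positive real, and $q$ a positive integer. If the fractional pinwheel covering instance $A\sqcup(a)$ is schedulable, then the instance $A\sqcup(a q, a q,\dots,a q)$, with $q$ added jobs each of period $aq$, is schedulable.
   Context: A fractional pinwheel covering instance is a finite list $(a_1,\dots,a_n)$ of positive reals. A schedule $f:\mathbb{N}\to\{1,\dots,n\}$ assigns each day to one job. It is valid if for every $i$ and every $d\in\mathbb{N}$, every block of $d$ consecutive days contains at most $\lceil d/a_i\rceil$ days assigned to job $i$. The instance is schedulable if a valid schedule exists. $A\sqcup(\cdots)$ denotes adding the listed jobs to $A$. -}

module Defs where

open import Data.Nat using (ℕ; zero; suc; _≤_)
open import Data.Integer using (+_)
open import Data.Rational using (ℚ; _/_; 0ℚ; _*_) renaming (_<_ to _<ℚ_)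
open import Data.Fin using (Fin; _≟_)
open import Data.List using (List; length; lookup)
open import Data.Product using (Σ; ∃; _×_)
open import Data.Sum using (_⊎_)
open import Data.Empty using (⊥)
open import Relation.Nullary using (¬_; yes; no)
open import Relation.Binary.PropositionalEquality using (_≡_)
open import Function.Bundles using (_⇔_)

-- Positive real numbers as two-sided Dedekind cuts of ℚ
-- (L = rationals strictly below, U = rationals strictly above).
record PosReal : Set₁ where
  field
    L : ℚ → Set
    U : ℚ → Set
    L-inhabited : ∃ λ p → L p
    U-inhabited : ∃ λ p → U p
    L-lower     : ∀ p r → p <ℚ r → L r → L p
    L-rounded   : ∀ p → L p → ∃ λ r → p <ℚ r × L r
    U-upper     : ∀ p r → p <ℚ r → U p → U r
    U-rounded   : ∀ r → U r → ∃ λ p → p <ℚ r × U p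
    disjoint    : ∀ p → L p → U p → ⊥
    located     : ∀ p r → p <ℚ r → L p ⊎ U r
    positive    : L 0ℚ

open PosReal public

-- k·a < d   (k, d natural numbers)
MulLt : ℕ → PosReal → ℕ → Set
MulLt zero    a d = 0 Data.Nat.< d
MulLt (suc k) a d = U a ((+ d) / suc k)

-- d ≤ k·a
LeMul : ℕ → ℕ → PosReal → Set
LeMul d zero    a = d ≡ 0
LeMul d (suc k) a = ¬ U a ((+ d) / suc k)

-- CeilDiv d a m  :⇔  m = ⌈d/a⌉, i.e.  (m-1)·a < d ≤ m·a  (and m = 0 iff d = 0)
CeilDiv : ℕ → PosReal → ℕ → Set
CeilDiv d a zero    = d ≡ 0
CeilDiv d a (suc k) = MulLt k a d × LeMul d (suc k) a

-- b is the real number a·q  (q a natural number; cuts correspond under p ↦ p·q)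
IsScaled : PosReal → ℕ → PosReal → Set
IsScaled a q b = ∀ p → (L a p ⇔ L b (p * ((+ q) / 1))) × (U a p ⇔ U b (p * ((+ q) / 1)))

Schedule : List PosReal → Set
Schedule A = ℕ → Fin (length A)

count : (A : List PosReal) → Schedule A → Fin (length A) → ℕ → ℕ → ℕ
count A f i s zero    = 0
count A f i s (suc d) with f s ≟ i
... | yes _ = suc (count A f i (suc s) d)
... | no  _ = count A f i (suc s) d

Valid : (A : List PosReal) → Schedule A → Set
Valid A f = ∀ (i : Fin (length A)) (s d m : ℕ) → CeilDiv d (lookup A i) m → count A f i s d ≤ m

Schedulable : List PosReal → Set
Schedulable A = Σ (Schedule A) (Valid A)

-- Route the days of the job of period a to the q new jobs of period a·q in
-- round-robin order, and leave all other days untouched.  In a block of d days,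
-- if job a occurs c times, then every copy occurs at most ⌈c/q⌉ times, and
-- c ≤ ⌈d/a⌉ ≤ q·⌈d/(aq)⌉ gives ⌈c/q⌉ ≤ ⌈d/(aq)⌉.
module Submission where

open import Defs
open import Data.Nat using (ℕ; _≥_)
open import Data.List using (List; _++_; [_]; replicate)

open import Data.Bool using (Bool; true; false; if_then_else_; _∧_)
open import Data.Empty using (⊥-elim)
open import Data.Fin as Fin using (Fin; toℕ)
open import Data.Fin.Properties using (suc-injective; toℕ-injective; toℕ≤pred[n])
open import Data.Integer as ℤ using (+_)
open import Data.Integer.Properties using (pos-*)
open import Data.List using (_∷_; []; length; lookup)
open import Data.List.Properties using (length-replicate)
open import Data.Nat as ℕ using (zero; suc; _+_; _*_; _∸_; _≤_; z≤n; s≤s; _≤?_)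
open import Data.Nat.Properties hiding (suc-injective)
open import Data.Nat.Tactic.RingSolver using (solve-∀)
open import Data.Product using (∃-syntax; _×_; _,_; proj₂)
open import Data.Rational using (_/_; toℚᵘ) renaming (_*_ to _*ℚ_)
open import Data.Rational.Properties using (toℚᵘ-injective; toℚᵘ-fromℚᵘ; toℚᵘ-homo-*)
import Data.Rational.Unnormalised as ℚᵘ
import Data.Rational.Unnormalised.Properties as ℚᵘ
open import Function.Base using (_∘_)
open import Function.Bundles using (_⇔_; mk⇔; Equivalence)
open import Relation.Nullary using (¬_; yes; no; does)
open import Relation.Nullary.Decidable using (dec-true; dec-false; does-⇔; decidable-stable; _×-dec_; ¬¬-excluded-middle)
open import Relation.Binary.PropositionalEquality hiding ([_])

d*[1+q]*[1+m]≡d*[[1+m]*[1+q]*1] : ∀ d m q → d * suc q * suc m ≡ d * (suc m * suc q * 1)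
d*[1+q]*[1+m]≡d*[[1+m]*[1+q]*1] = solve-∀

d/[m*q]*q≡d/m : ∀ d m q → (+ d / (suc m * suc q)) *ℚ (+ suc q / 1) ≡ + d / suc m
d/[m*q]*q≡d/m d m q = toℚᵘ-injective (begin
  toℚᵘ (x *ℚ y)                                           ≈⟨ toℚᵘ-homo-* x y ⟩
  toℚᵘ x ℚᵘ.* toℚᵘ y                                      ≈⟨ ℚᵘ.*-cong (toℚᵘ-fromℚᵘ x′) (toℚᵘ-fromℚᵘ y′) ⟩
  x′ ℚᵘ.* y′                                              ≈⟨ ℚᵘ.*≡* cross ⟩
  ℚᵘ.mkℚᵘ (+ d) m                                         ≈⟨ ℚᵘ.≃-sym (toℚᵘ-fromℚᵘ (ℚᵘ.mkℚᵘ (+ d) m)) ⟩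
  toℚᵘ (+ d / suc m)                                      ∎)
  where
  open ℚᵘ.≃-Reasoning
  x = + d / (suc m * suc q)
  y = + suc q / 1
  x′ = ℚᵘ.mkℚᵘ (+ d) (q + m * suc q)
  y′ = ℚᵘ.mkℚᵘ (+ suc q) 0
  cross : (+ d ℤ.* + suc q) ℤ.* + suc m ≡ + d ℤ.* + (suc m * suc q * 1)
  cross = trans (cong (ℤ._* + suc m) (sym (pos-* d (suc q))))
         (trans (sym (pos-* (d * suc q) (suc m)))
         (trans (cong +_ (d*[1+q]*[1+m]≡d*[[1+m]*[1+q]*1] d m q))
                (pos-* d (suc m * suc q * 1))))

LeMul-scale : ∀ {a b q′ d m} → IsScaled a (suc q′) b → LeMul d (suc m) b → LeMul d (suc m * suc q′) a
LeMul-scale {a} {b} {q′} {d} {m} a·q≡b d≤[1+m]b d/[[1+m]q]∈Ua =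
  d≤[1+m]b (subst (U b) (d/[m*q]*q≡d/m d m q′) (Equivalence.to (proj₂ (a·q≡b _)) d/[[1+m]q]∈Ua))

-- Locating ⌈d/a⌉ needs excluded middle for the cut U a; count≤ then escapes the
-- double negation because ≤ on ℕ is decidable.
¬¬ceilDiv≤ : ∀ a d n → LeMul d (suc n) a → ¬ ¬ (∃[ m ] m ≤ suc n × CeilDiv d a m)
¬¬ceilDiv≤ a zero    n       _         ¬∃ = ¬∃ (0 , z≤n , refl)
¬¬ceilDiv≤ a (suc d) zero    d≤a       ¬∃ = ¬∃ (1 , ≤-refl , s≤s z≤n , d≤a)
¬¬ceilDiv≤ a (suc d) (suc n) d≤[2+n]a ¬∃ = ¬¬-excluded-middle λ where
  (yes [1+n]a<d) → ¬∃ (suc (suc n) , ≤-refl , [1+n]a<d , d≤[2+n]a)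
  (no  d≤[1+n]a) → ¬¬ceilDiv≤ a (suc d) n d≤[1+n]a λ (m , m≤1+n , d/a≡m) → ¬∃ (m , m≤n⇒m≤1+n m≤1+n , d/a≡m)

count≤ : ∀ {A f} → Valid A f → ∀ i s d n → LeMul d (suc n) (lookup A i) → count A f i s d ≤ suc n
count≤ f-valid i s d n d≤[1+n]a = decidable-stable (_ ≤? _) λ count≰1+n →
  ¬¬ceilDiv≤ _ d n d≤[1+n]a λ (m , m≤1+n , d/a≡m) → count≰1+n (≤-trans (f-valid i s d m d/a≡m) m≤1+n)

countᵇ : (ℕ → Bool) → ℕ → ℕ → ℕ
countᵇ p s zero    = 0
countᵇ p s (suc d) = if p s then suc (countᵇ p (suc s) d) else countᵇ p (suc s) d

countᵇ-cong : ∀ {p p′} → (∀ t → p t ≡ p′ t) → ∀ s d → countᵇ p s d ≡ countᵇ p′ s d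
countᵇ-cong p≗p′ s zero    = refl
countᵇ-cong p≗p′ s (suc d) =
  cong₂ (λ b c → if b then suc c else c) (p≗p′ s) (countᵇ-cong p≗p′ (suc s) d)

count≡countᵇ : ∀ A (f : Schedule A) i s d → count A f i s d ≡ countᵇ (λ t → does (f t Fin.≟ i)) s d
count≡countᵇ A f i s zero = refl
count≡countᵇ A f i s (suc d) with f s Fin.≟ i
... | yes _ = cong suc (count≡countᵇ A f i (suc s) d)
... | no  _ = count≡countᵇ A f i (suc s) d

count-cong : ∀ {A B} (f : Schedule A) (g : Schedule B) i j → (∀ t → f t ≡ i ⇔ g t ≡ j) →
             ∀ s d → count A f i s d ≡ count B g j s d
count-cong {A} {B} f g i j f≡i⇔g≡j s d = begin
  count A f i s d                            ≡⟨ count≡countᵇ A f i s d ⟩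
  countᵇ (λ t → does (f t Fin.≟ i)) s d      ≡⟨ countᵇ-cong (λ t → does-⇔ (f≡i⇔g≡j t) (f t Fin.≟ i) (g t Fin.≟ j)) s d ⟩
  countᵇ (λ t → does (g t Fin.≟ j)) s d      ≡⟨ count≡countᵇ B g j s d ⟨
  count B g j s d                            ∎
  where open ≡-Reasoning

module Rotation (q′ : ℕ) where

  next : ℕ → ℕ
  next zero    = q′
  next (suc e) = e

  next≤ : ∀ {e} → e ≤ q′ → next e ≤ q′
  next≤ {zero}  _       = ≤-refl
  next≤ {suc e} 1+e≤q′ = ≤-trans (n≤1+n e) 1+e≤q′

  state : (ℕ → Bool) → ℕ → ℕ
  state p zero    = zero
  state p (suc t) = if p t then next (state p t) else state p t

  state≤ : ∀ p t → state p t ≤ q′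
  state≤ p zero    = z≤n
  state≤ p (suc t) with p t
  ... | true  = next≤ (state≤ p t)
  ... | false = state≤ p t

  hits : (ℕ → Bool) → ℕ → ℕ → Bool
  hits p j t = p t ∧ does (state p t ℕ.≟ j)

  -- The number of applications of next that lead from e to j.
  dist : ℕ → ℕ → ℕ
  dist j e with j ≤? e
  ... | yes _ = e ∸ j
  ... | no  _ = e + (suc q′ ∸ j)

  dist≤ : ∀ {j e} → j ≤ q′ → e ≤ q′ → dist j e ≤ q′
  dist≤ {j} {e} j≤q′ e≤q′ with j ≤? e
  ... | yes _   = ≤-trans (m∸n≤m e j) e≤q′
  ... | no  j≰e = begin
    e + (suc q′ ∸ j) ≤⟨ +-monoʳ-≤ e (∸-monoʳ-≤ (suc q′) (≰⇒> j≰e)) ⟩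
    e + (q′ ∸ e)     ≡⟨ m+[n∸m]≡n e≤q′ ⟩
    q′               ∎
    where open ≤-Reasoning

  dist-self : ∀ j → dist j j ≡ 0
  dist-self j with j ≤? j
  ... | yes _   = n∸n≡0 j
  ... | no  j≰j = ⊥-elim (j≰j ≤-refl)

  dist-next-self : ∀ {j} → j ≤ q′ → dist j (next j) ≡ q′
  dist-next-self {zero} _ with 0 ≤? q′
  ... | yes _   = refl
  ... | no  0≰q′ = ⊥-elim (0≰q′ z≤n)
  dist-next-self {suc j} 1+j≤q′ with suc j ≤? j
  ... | yes 1+j≤j = ⊥-elim (n≮n j 1+j≤j)
  ... | no  _     = m+[n∸m]≡n (≤-pred (m≤n⇒m≤1+n 1+j≤q′))

  dist-next : ∀ {j e} → j ≤ q′ → e ≢ j → dist j e ≡ suc (dist j (next e))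
  dist-next {zero}  {zero}  _      0≢0 = ⊥-elim (0≢0 refl)
  dist-next {suc j} {zero}  1+j≤q′ _   with suc j ≤? q′
  ... | yes _     = +-∸-assoc 1 1+j≤q′
  ... | no  1+j≰q′ = ⊥-elim (1+j≰q′ 1+j≤q′)
  dist-next {j} {suc e} _ 1+e≢j with j ≤? suc e | j ≤? e
  ... | yes _     | yes j≤e = +-∸-assoc 1 j≤e
  ... | yes j≤1+e | no  j≰e = ⊥-elim (1+e≢j (sym (≤-antisym j≤1+e (≰⇒> j≰e))))
  ... | no  j≰1+e | yes j≤e = ⊥-elim (j≰1+e (m≤n⇒m≤1+n j≤e))
  ... | no  _     | no  _   = refl

  -- dist j (state p s) is a potential: it drops by one on a p-day that misses j
  -- and rises from 0 to q′ on a hit.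
  rotation-potential : ∀ p {j} → j ≤ q′ → ∀ s d →
    suc q′ * countᵇ (hits p j) s d + dist j (state p s) ≤ countᵇ p s d + q′
  rotation-potential p {j} j≤q′ s zero = begin
    suc q′ * 0 + dist j (state p s) ≡⟨ cong (_+ dist j (state p s)) (*-zeroʳ (suc q′)) ⟩
    dist j (state p s)              ≤⟨ dist≤ j≤q′ (state≤ p s) ⟩
    q′                              ∎
    where open ≤-Reasoning
  rotation-potential p {j} j≤q′ s (suc d)
    with IH ← rotation-potential p j≤q′ (suc s) d | p s | state p s ℕ.≟ j
  -- does (m ℕ.≟ n) computes to m ≡ᵇ n, which the with-abstraction misses; hence the rewrites.
  ... | false | _ = IH
  ... | true | yes refl rewrite dec-true (state p s ℕ.≟ state p s) refl = begin
    suc q′ * suc H + dist j j           ≡⟨ cong (_+_ (suc q′ * suc H)) (dist-self j) ⟩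
    suc q′ * suc H + 0                  ≡⟨ +-identityʳ _ ⟩
    suc q′ * suc H                      ≡⟨ *-suc (suc q′) H ⟩
    suc q′ + suc q′ * H                 ≡⟨ cong suc (+-comm q′ _) ⟩
    suc (suc q′ * H + q′)               ≡⟨ cong (λ δ → suc (suc q′ * H + δ)) (dist-next-self j≤q′) ⟨
    suc (suc q′ * H + dist j (next j))  ≤⟨ s≤s IH ⟩
    suc (C + q′)                        ∎
    where
    open ≤-Reasoning
    H = countᵇ (hits p j) (suc s) d
    C = countᵇ p (suc s) d
  ... | true | no e≢j rewrite dec-false (state p s ℕ.≟ j) e≢j = begin
    suc q′ * H + dist j e               ≡⟨ cong (_+_ (suc q′ * H)) (dist-next j≤q′ e≢j) ⟩
    suc q′ * H + suc (dist j (next e))  ≡⟨ +-suc _ _ ⟩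
    suc (suc q′ * H + dist j (next e))  ≤⟨ s≤s IH ⟩
    suc (C + q′)                        ∎
    where
    open ≤-Reasoning
    e = state p s
    H = countᵇ (hits p j) (suc s) d
    C = countᵇ p (suc s) d

  rotation-bound : ∀ p {j} → j ≤ q′ → ∀ s d → suc q′ * countᵇ (hits p j) s d ≤ countᵇ p s d + q′
  rotation-bound p j≤q′ s d = ≤-trans (m≤m+n _ _) (rotation-potential p j≤q′ s d)

module _ {X : Set₁} where

  embˡ : (A B : List X) → Fin (length A) → Fin (length (A ++ B))
  embˡ (_ ∷ A) B Fin.zero    = Fin.zero
  embˡ (_ ∷ A) B (Fin.suc i) = Fin.suc (embˡ A B i)

  embʳ : (A B : List X) → Fin (length B) → Fin (length (A ++ B))
  embʳ []      B k = k
  embʳ (_ ∷ A) B k = Fin.suc (embʳ A B k)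

  data Split (A B : List X) : Fin (length (A ++ B)) → Set where
    left  : ∀ i → Split A B (embˡ A B i)
    right : ∀ k → Split A B (embʳ A B k)

  split : ∀ A B x → Split A B x
  split []      B x           = right x
  split (_ ∷ A) B Fin.zero    = left Fin.zero
  split (_ ∷ A) B (Fin.suc x) with split A B x
  ... | left i  = left (Fin.suc i)
  ... | right k = right k

  embˡ-injective : ∀ A B {i j} → embˡ A B i ≡ embˡ A B j → i ≡ j
  embˡ-injective (_ ∷ A) B {Fin.zero}  {Fin.zero}  _   = refl
  embˡ-injective (_ ∷ A) B {Fin.suc i} {Fin.suc j} i≡j =
    cong Fin.suc (embˡ-injective A B (suc-injective i≡j))

  embʳ-injective : ∀ A B {k l} → embʳ A B k ≡ embʳ A B l → k ≡ l
  embʳ-injective []      B k≡l = k≡l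
  embʳ-injective (_ ∷ A) B k≡l = embʳ-injective A B (suc-injective k≡l)

  embˡ≢embʳ : ∀ A B i k → embˡ A B i ≢ embʳ A B k
  embˡ≢embʳ (_ ∷ A) B Fin.zero    k ()
  embˡ≢embʳ (_ ∷ A) B (Fin.suc i) k i≡k = embˡ≢embʳ A B i k (suc-injective i≡k)

  lookup-embˡ : ∀ A B i → lookup (A ++ B) (embˡ A B i) ≡ lookup A i
  lookup-embˡ (_ ∷ A) B Fin.zero    = refl
  lookup-embˡ (_ ∷ A) B (Fin.suc i) = lookup-embˡ A B i

  lookup-embʳ : ∀ A B k → lookup (A ++ B) (embʳ A B k) ≡ lookup B k
  lookup-embʳ []      B k = refl
  lookup-embʳ (_ ∷ A) B k = lookup-embʳ A B k

module _ {X : Set₁} (x : X) where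

  -- Junk value: positions beyond n are sent to the last one.
  copy : ∀ n → ℕ → Fin (length (replicate (suc n) x))
  copy zero    _       = Fin.zero
  copy (suc n) zero    = Fin.zero
  copy (suc n) (suc e) = Fin.suc (copy n e)

  toℕ-copy : ∀ {n e} → e ≤ n → toℕ (copy n e) ≡ e
  toℕ-copy {zero}  z≤n       = refl
  toℕ-copy {suc n} z≤n       = refl
  toℕ-copy {suc n} (s≤s e≤n) = cong suc (toℕ-copy e≤n)

  copy≡⇔ : ∀ {n e} k → e ≤ n → copy n e ≡ k ⇔ e ≡ toℕ k
  copy≡⇔ k e≤n = mk⇔ (λ copy≡k → trans (sym (toℕ-copy e≤n)) (cong toℕ copy≡k))
                     (λ e≡k → toℕ-injective (trans (toℕ-copy e≤n) e≡k))

  toℕ≤ : ∀ n (k : Fin (length (replicate (suc n) x))) → toℕ k ≤ n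
  toℕ≤ n k = ≤-trans (toℕ≤pred[n] k) (≤-reflexive (length-replicate n))

  lookup-replicate′ : ∀ n k → lookup (replicate n x) k ≡ x
  lookup-replicate′ (suc n) Fin.zero    = refl
  lookup-replicate′ (suc n) (Fin.suc k) = lookup-replicate′ n k

[1+q]*h≤m*[1+q]+q⇒h≤m : ∀ q h m → suc q * h ≤ m * suc q + q → h ≤ m
[1+q]*h≤m*[1+q]+q⇒h≤m q h m [1+q]h≤m[1+q]+q = ≤-pred (*-cancelˡ-< (suc q) h (suc m) (begin-strict
  suc q * h           ≤⟨ [1+q]h≤m[1+q]+q ⟩
  m * suc q + q       <⟨ +-monoʳ-< (m * suc q) (n<1+n q) ⟩
  m * suc q + suc q   ≡⟨ +-comm (m * suc q) (suc q) ⟩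
  suc m * suc q       ≡⟨ *-comm (suc m) (suc q) ⟩
  suc q * suc m       ∎))
  where open ≤-Reasoning

module RoundRobin (A : List PosReal) (a b : PosReal) (q′ : ℕ) (f : Schedule (A ++ [ a ])) where

  open Rotation q′

  copies : List PosReal
  copies = replicate (suc q′) b

  a-job : Fin (length (A ++ [ a ]))
  a-job = embʳ A [ a ] Fin.zero

  on-a : ℕ → Bool
  on-a t = does (f t Fin.≟ a-job)

  route : Fin (length (A ++ [ a ])) → ℕ → Fin (length (A ++ copies))
  route x e with split A [ a ] x
  ... | left i  = embˡ A copies i
  ... | right _ = embʳ A copies (copy b q′ e)

  g : Schedule (A ++ copies)
  g t = route (f t) (state on-a t)

  route≡embˡ⇔ : ∀ x e i → route x e ≡ embˡ A copies i ⇔ x ≡ embˡ A [ a ] i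
  route≡embˡ⇔ x e i with split A [ a ] x
  ... | left j  = mk⇔ (cong (embˡ A [ a ]) ∘ embˡ-injective A copies)
                      (cong (embˡ A copies) ∘ embˡ-injective A [ a ])
  ... | right k = mk⇔ (λ eq → ⊥-elim (embˡ≢embʳ A copies i _ (sym eq)))
                      (λ eq → ⊥-elim (embˡ≢embʳ A [ a ] i k (sym eq)))

  route≡embʳ⇔ : ∀ x {e} k → e ≤ q′ → route x e ≡ embʳ A copies k ⇔ (x ≡ a-job × e ≡ toℕ k)
  route≡embʳ⇔ x k e≤q′ with split A [ a ] x
  ... | left i         = mk⇔ (λ eq → ⊥-elim (embˡ≢embʳ A copies i k eq))
                             (λ (eq , _) → ⊥-elim (embˡ≢embʳ A [ a ] i Fin.zero eq))
  ... | right Fin.zero = mk⇔ (λ eq → refl , to (copy≡⇔ b k e≤q′) (embʳ-injective A copies eq))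
                             (λ (_ , e≡k) → cong (embʳ A copies) (from (copy≡⇔ b k e≤q′) e≡k))
    where open Equivalence

  count-embˡ : ∀ i s d → count (A ++ copies) g (embˡ A copies i) s d ≡ count (A ++ [ a ]) f (embˡ A [ a ] i) s d
  count-embˡ i = count-cong g f _ _ λ t → route≡embˡ⇔ (f t) (state on-a t) i

  count-embʳ : ∀ k s d →
    suc q′ * count (A ++ copies) g (embʳ A copies k) s d ≤ count (A ++ [ a ]) f a-job s d + q′
  count-embʳ k s d = begin
    suc q′ * count (A ++ copies) g (embʳ A copies k) s d ≡⟨ cong (suc q′ *_) count-hits ⟩
    suc q′ * countᵇ (hits on-a (toℕ k)) s d             ≤⟨ rotation-bound on-a (toℕ≤ b q′ k) s d ⟩
    countᵇ on-a s d + q′                                ≡⟨ cong (_+ q′) (count≡countᵇ _ f a-job s d) ⟨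
    count (A ++ [ a ]) f a-job s d + q′                 ∎
    where
    open ≤-Reasoning
    count-hits : count (A ++ copies) g (embʳ A copies k) s d ≡ countᵇ (hits on-a (toℕ k)) s d
    count-hits = trans (count≡countᵇ _ g _ s d) (countᵇ-cong (λ t →
      does-⇔ (route≡embʳ⇔ (f t) k (state≤ on-a t))
             (g t Fin.≟ embʳ A copies k) ((f t Fin.≟ a-job) ×-dec (state on-a t ℕ.≟ toℕ k))) s d)


lemma2p2 : (A : List PosReal) (a : PosReal) (q : ℕ) → q ≥ 1 → (b : PosReal) → IsScaled a q b
    → Schedulable (A ++ [ a ]) → Schedulable (A ++ replicate q b)
lemma2p2 A a (suc q′) _ b a·q≡b (f , f-valid) = g , g-valid
  where
  open RoundRobin A a b q′ f

  copy-valid : ∀ k s d m → CeilDiv d b m → count (A ++ copies) g (embʳ A copies k) s d ≤ m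
  copy-valid k s d zero    refl             = z≤n
  copy-valid k s d (suc m) (_ , d≤[1+m]b) = [1+q]*h≤m*[1+q]+q⇒h≤m q′ _ (suc m) (begin
    suc q′ * count (A ++ copies) g (embʳ A copies k) s d ≤⟨ count-embʳ k s d ⟩
    count (A ++ [ a ]) f a-job s d + q′                 ≤⟨ +-monoˡ-≤ q′ (count≤ f-valid a-job s d _ d≤[[1+m]q]a) ⟩
    suc m * suc q′ + q′                                 ∎)
    where
    open ≤-Reasoning
    d≤[[1+m]q]a = subst (LeMul d (suc m * suc q′)) (sym (lookup-embʳ A [ a ] Fin.zero)) (LeMul-scale {a} {b} {q′} {d} {m} a·q≡b d≤[1+m]b)

  g-valid : Valid (A ++ copies) g
  g-valid x s d m d/x≡m with split A copies x
  ... | left i  = subst (_≤ m) (sym (count-embˡ i s d))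
                    (f-valid _ s d m (subst (λ c → CeilDiv d c m) (trans (lookup-embˡ A copies i) (sym (lookup-embˡ A [ a ] i))) d/x≡m))
  ... | right k = copy-valid k s d m
                    (subst (λ c → CeilDiv d c m) (trans (lookup-embʳ A copies k) (lookup-replicate′ b (suc q′) k)) d/x≡m)
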